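{- Let $P$ be a dual-normal program and let $F(P)$ be the propositional formula defined below. Then the set of answer sets of $P$ equals $\{M\cap\mathrm{at}(P)\mid M \text{ a model of } F(P)\}$. Construction of $F(P)$: let $p=|\mathrm{at}(P)|$ and let $t$ be a fresh variable. Variables are the atoms $a\in\mathrm{at}(P)$ and fresh variables $a^i_m$ for $a\in\mathrm{at}(P)\cup\{t\}$, $m\in\mathrm{at}(P)$, $0\le i\le p$. For a set $B$ of atoms, $P_r\sqcap B=\{r\in P_r\mid B^+(r)=B\}$. For a set $R$ of rules, $C^i_m(R)=\bigwedge_{r\in R}\big(\bigvee_{a\in H(r)}a^{i-1}_m\vee\bigvee_{a\in B^-(r)}a\big)$. Let $F^0_m=\neg m^0_m\wedge t^0_m\wedge\bigwedge_{a\in\mathrm{at}(P)\setminus\{m\}}(a^0_m\leftrightarrow a)$, and for $1\le i\le p$, $F^i_m=\bigwedge_{a\in\mathrm{at}(P)\setminus\{m\}}\big(a^i_m\leftrightarrow(a^{i-1}_m\wedge C^i_m(P_r\sqcap\{a\}))\big)\wedge\big(t^i_m\leftrightarrow(t^{i-1}_m\wedge C^i_m(P_r\sqcap\emptyset))\big)$. Let $F_{\mathrm{Mod}}=\bigwedge_{r\in P}\big(\bigvee_{a\in H(r)\cup B^-(r)}a\vee\bigvee_{a\in B^+(r)}\neg a\big)$, and $F(P)=F_{\mathrm{Mod}}\wedge\bigwedge_{a\in\mathrm{at}(P)}\Big[a\rightarrow\Big(\bigwedge_{i=0}^pF^i_a\wedge\neg t^p_a\Big)\Big]$.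
   Context: A rule $r$ is an expression $a_1\vee\cdots\vee a_l\leftarrow a_{l+1},\ldots,a_m,\mathit{not}\ a_{m+1},\ldots,\mathit{not}\ a_n$ with propositional atoms; $H(r)$ is the set of head atoms, $B^+(r)$ and $B^-(r)$ the positive and negative body atoms; a constraint has $H(r)=\emptyset$. A program is a finite set of rules; $\mathrm{at}(P)$ its atoms; $P_r=\{r\in P\mid H(r)\ne\emptyset\}$. A set $I$ of atoms satisfies $r$ if $(H(r)\cup B^-(r))\cap I\neq\emptyset$ or $B^+(r)\setminus I\neq\emptyset$; a model of $P$ satisfies all rules. Reduct: $P^I=\{H(r)\leftarrow B^+(r)\mid r\in P, I\cap B^-(r)=\emptyset\}$. $I$ is an answer set of $P$ if it is an inclusion-minimal model of $P^I$. $P$ is dual-normal if each rule is a constraint or satisfies $|B^+(r)|\le1$. A model of a propositional formula is identified with the set of variables it makes true. Empty conjunctions are true, empty disjunctions false. -}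

module Defs where

open import Data.Nat using (ℕ; zero; suc; _≤_; _≡ᵇ_)
open import Data.Nat.Properties using (_≟_)
open import Data.Bool using (Bool; true; false; _∧_; _∨_; not; if_then_else_)
open import Data.Maybe using (Maybe; just; nothing)
open import Data.List using (List; []; _∷_; _++_; map; foldr; concatMap; filter; length; deduplicate; null; upTo)
open import Data.Bool.ListAction using (all; any)
open import Data.List.Relation.Unary.All using (All)
open import Data.List.Relation.Unary.Any using (Any)
open import Data.Product using (Σ; _×_; _,_)
open import Data.Sum using (_⊎_)
open import Relation.Binary.PropositionalEquality using (_≡_)
open import Relation.Nullary using (¬_)
open import Relation.Nullary.Decidable using (¬?)

Atom : Set
Atom = ℕ

-- a rule  head₁ ∨ … ← pos…, not neg…   (lists are read as sets)
record Rule : Set where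
  constructor rule
  field
    head : List Atom
    pos  : List Atom
    neg  : List Atom
open Rule public

Program : Set
Program = List Rule

atP : Program → List Atom
atP P = deduplicate _≟_ (concatMap (λ r → head r ++ pos r ++ neg r) P)

AtomSet : Set
AtomSet = Atom → Bool

_⊆_ : AtomSet → AtomSet → Set
J ⊆ I = ∀ a → J a ≡ true → I a ≡ true

DualNormal : Program → Set
DualNormal P = All (λ r → head r ≡ [] ⊎ length (deduplicate _≟_ (pos r)) ≤ 1) P

Satisfies : AtomSet → Rule → Set
Satisfies I r = Any (λ a → I a ≡ true) (head r ++ neg r) ⊎ Any (λ a → I a ≡ false) (pos r)

Model : AtomSet → Program → Set
Model I P = All (Satisfies I) P

ModelOfReduct : AtomSet → Program → AtomSet → Set
ModelOfReduct J P I =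
  All (λ r → All (λ a → I a ≡ false) (neg r) →
             Any (λ a → J a ≡ true) (head r) ⊎ Any (λ a → J a ≡ false) (pos r)) P

AnswerSet : Program → AtomSet → Set
AnswerSet P I = ModelOfReduct I P I × (∀ J → J ⊆ I → ModelOfReduct J P I → I ⊆ J)

-- Variables: atoms a, and fresh variables a^i_m written sup x i m,
-- where x = just a for a ∈ at(P) and x = nothing for the fresh t.
data Var : Set where
  atom : Atom → Var
  sup  : Maybe Atom → ℕ → Atom → Var

data Formula : Set where
  var        : Var → Formula
  ⊤f ⊥f      : Formula
  ¬f_        : Formula → Formula
  _∧f_ _∨f_ _⇒f_ _⇔f_ : Formula → Formula → Formula

eval : (Var → Bool) → Formula → Bool
eval M (var x)   = M x
eval M ⊤f        = true
eval M ⊥f        = false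
eval M (¬f φ)    = not (eval M φ)
eval M (φ ∧f ψ)  = eval M φ ∧ eval M ψ
eval M (φ ∨f ψ)  = eval M φ ∨ eval M ψ
eval M (φ ⇒f ψ)  = not (eval M φ) ∨ eval M ψ
eval M (φ ⇔f ψ)  = (eval M φ ∧ eval M ψ) ∨ (not (eval M φ) ∧ not (eval M ψ))

⋀ : List Formula → Formula
⋀ = foldr _∧f_ ⊤f

⋁ : List Formula → Formula
⋁ = foldr _∨f_ ⊥f

module Translation (P : Program) where

  at : List Atom
  at = atP P

  p : ℕ
  p = length at

  atWithout : Atom → List Atom
  atWithout m = filter (λ a → ¬? (a ≟ m)) at

  v : Maybe Atom → ℕ → Atom → Formula
  v x i m = var (sup x i m)

  Pr : List Rule
  Pr = filter (λ r → ¬? (Data.List.null (head r) Data.Bool.≟ true)) P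
    where import Data.Bool

  PrSingleton : Atom → List Rule
  PrSingleton a = filter (λ r → Data.Bool._≟_ (not (null (pos r)) ∧ all (λ b → b ≡ᵇ a) (pos r)) true) Pr
    where import Data.Bool

  PrEmpty : List Rule
  PrEmpty = filter (λ r → Data.Bool._≟_ (null (pos r)) true) Pr
    where import Data.Bool

  -- C^{j+1}_m(R)  (the superscript i-1 is j)
  C : ℕ → Atom → List Rule → Formula
  C j m R = ⋀ (map (λ r → ⋁ (map (λ a → v (just a) j m) (head r) ++ map (λ a → var (atom a)) (neg r))) R)

  F : ℕ → Atom → Formula
  F zero m = (¬f v (just m) 0 m) ∧f (v nothing 0 m ∧f
             ⋀ (map (λ a → v (just a) 0 m ⇔f var (atom a)) (atWithout m)))
  F (suc j) m = ⋀ (map (λ a → v (just a) (suc j) m ⇔f (v (just a) j m ∧f C j m (PrSingleton a))) (atWithout m))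
                ∧f (v nothing (suc j) m ⇔f (v nothing j m ∧f C j m PrEmpty))

  FMod : Formula
  FMod = ⋀ (map (λ r → ⋁ (map (λ a → var (atom a)) (head r ++ neg r)) ∨f ⋁ (map (λ a → ¬f var (atom a)) (pos r))) P)

  FP : Formula
  FP = FMod ∧f ⋀ (map (λ a → var (atom a) ⇒f (⋀ (map (λ i → F i a) (upTo (suc p))) ∧f (¬f v nothing p a))) at)

FP : Program → Formula
FP P = Translation.FP P

inAt : Program → Atom → Bool
inAt P a = any (λ b → b ≡ᵇ a) (atP P)

module Submission where

-- For a valuation M let L^i_m = {a | M(a^i_m)}.  F^0_m fixes L^0_m = M ∖ {m} on at(P)
-- and sets t^0_m; F^{i+1}_m keeps in L^{i+1}_m the atoms a of L^i_m whose rules in P_r ⊓ {a}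
-- are all "covered" (a head atom in L^i_m or a negative body atom true), and t^{i+1}_m
-- says t^i_m holds and P_r ⊓ ∅ is covered.
-- Soundness: F_Mod makes I a model of P; a model J ⊆ I of P^I missing m ∈ I covers every
-- rule whose positive body it contains, so J ⊆ L^i_m and t^i_m for all i ≤ p, against ¬t^p_m.
-- Completeness: for an answer set I compute the chains L^i_m, t^i_m from I.  A descending
-- chain of subsets of a p-element list that starts on a proper subset stabilises before
-- step p; if t^p_m held, dual-normality would make the stable level a model of P^I below
-- I and missing m, against minimality.

open import Defs
open import Data.Bool using (Bool; true; false; _∧_; _∨_; not; if_then_else_)
open import Data.Bool.Properties using (∨-assoc; ∧-identityʳ; ∧-zeroʳ; ¬-not)
open import Data.Nat using (ℕ; zero; suc; _≤_; _<_; _+_; _≡ᵇ_; z≤n; s≤s; s≤s⁻¹)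
open import Data.Nat.Properties
  using (_≟_; ≤-refl; ≤-trans; ≤-reflexive; m≤n⇒m≤1+n; m<n⇒m<1+n; n<1+n; <⇒≤;
         <-irrefl; ≤⇒≯; m≤n⇒m<n∨m≡n; +-suc; +-identityʳ; +-monoˡ-≤; m≤n+m; module ≤-Reasoning)
open import Data.Maybe using (just; nothing)
open import Data.List using (List; []; _∷_; _++_; map; length; upTo; null; deduplicate)
open import Data.Bool.ListAction using (all; any)
open import Data.List.Relation.Unary.All as All using (All; []; _∷_)
open import Data.List.Relation.Unary.Any as Any using (Any; here; there)
open import Data.List.Relation.Unary.Any.Properties using (¬Any[]; ++⁺ˡ; ++⁺ʳ; ++⁻)
open import Data.List.Membership.Propositional using (_∈_; find; lose)
open import Data.List.Membership.Propositional.Properties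
  using (∈-filter⁺; ∈-filter⁻; ∈-deduplicate⁺; ∈-concatMap⁺; ∈-upTo⁺; ∈-upTo⁻;
         ∈-++⁺ˡ; ∈-++⁺ʳ; ∈-++⁻)
open import Data.Product using (Σ; _×_; _,_; proj₁; proj₂)
open import Data.Sum using (_⊎_; inj₁; inj₂)
open import Data.Empty using (⊥; ⊥-elim)
open import Function.Bundles using (_⇔_; mk⇔; Equivalence)
open import Relation.Binary.PropositionalEquality using (_≡_; _≢_; refl; sym; trans; cong; cong₂; subst)
open import Relation.Nullary using (yes; no)

open Equivalence using (to; from)

true≢false : ∀ {x} → x ≡ true → x ≡ false → ⊥
true≢false refl ()

∧-projˡ : ∀ {x y} → x ∧ y ≡ true → x ≡ true
∧-projˡ {true} _ = refl

∧-projʳ : ∀ {x y} → x ∧ y ≡ true → y ≡ true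
∧-projʳ {true} e = e

∧-intro : ∀ {x y} → x ≡ true → y ≡ true → x ∧ y ≡ true
∧-intro refl refl = refl

∧-absorb : ∀ {x y} → (x ≡ true → y ≡ true) → x ≡ x ∧ y
∧-absorb {false} _ = refl
∧-absorb {true} h = sym (h refl)

∨-injˡ : ∀ {x} y → x ≡ true → x ∨ y ≡ true
∨-injˡ y refl = refl

∨-injʳ : ∀ x {y} → y ≡ true → x ∨ y ≡ true
∨-injʳ true _ = refl
∨-injʳ false e = e

∨-resolve : ∀ {x y} → x ∨ y ≡ true → y ≡ false → x ≡ true
∨-resolve {true} _ _ = refl
∨-resolve {false} e y≡false = ⊥-elim (true≢false e y≡false)

not-true : ∀ {x} → not x ≡ true → x ≡ false
not-true {false} _ = refl

not-false : ∀ {x} → x ≡ false → not x ≡ true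
not-false refl = refl

iff-true : ∀ {x y} → (x ∧ y) ∨ (not x ∧ not y) ≡ true → x ≡ y
iff-true {true} {true} _ = refl
iff-true {false} {false} _ = refl

iff-intro : ∀ {x y} → x ≡ y → (x ∧ y) ∨ (not x ∧ not y) ≡ true
iff-intro {true} refl = refl
iff-intro {false} refl = refl

imp-elim : ∀ {x y} → not x ∨ y ≡ true → x ≡ true → y ≡ true
imp-elim e refl = e

imp-intro : ∀ {x y} → (x ≡ true → y ≡ true) → not x ∨ y ≡ true
imp-intro {true} h = h refl
imp-intro {false} _ = refl

⊆-false : ∀ {J I : AtomSet} → J ⊆ I → ∀ {a} → I a ≡ false → J a ≡ false
⊆-false {J} J⊆I {a} Ia = ¬-not λ Ja → true≢false (J⊆I a Ja) Ia

module _ {A : Set} where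

  all-elim : ∀ {f : A → Bool} {xs x} → all f xs ≡ true → x ∈ xs → f x ≡ true
  all-elim {xs = _ ∷ _} e (here refl) = ∧-projˡ e
  all-elim {f} {y ∷ _} e (there xm) = all-elim (∧-projʳ {f y} e) xm

  all-intro : ∀ {f : A → Bool} {xs} → (∀ {x} → x ∈ xs → f x ≡ true) → all f xs ≡ true
  all-intro {xs = []} _ = refl
  all-intro {xs = _ ∷ _} h = ∧-intro (h (here refl)) (all-intro (λ xm → h (there xm)))

  all-cong : ∀ {f g : A → Bool} xs → (∀ x → f x ≡ g x) → all f xs ≡ all g xs
  all-cong [] _ = refl
  all-cong (y ∷ ys) h = cong₂ _∧_ (h y) (all-cong ys h)

  any-elim : ∀ {f : A → Bool} {xs} → any f xs ≡ true → Any (λ x → f x ≡ true) xs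
  any-elim {f} {y ∷ ys} e with f y in fy
  ... | true = here fy
  ... | false = there (any-elim e)

  any-intro : ∀ {f : A → Bool} {xs} → Any (λ x → f x ≡ true) xs → any f xs ≡ true
  any-intro {f} {y ∷ _} (here e) = ∨-injˡ _ e
  any-intro {f} {y ∷ _} (there q) = ∨-injʳ (f y) (any-intro q)

  any-false-elim : ∀ {f : A → Bool} {xs} → any f xs ≡ false → All (λ x → f x ≡ false) xs
  any-false-elim {xs = []} _ = []
  any-false-elim {f} {y ∷ _} e with f y in fy
  ... | false = fy ∷ any-false-elim e

  any-false-intro : ∀ {f : A → Bool} {xs} → All (λ x → f x ≡ false) xs → any f xs ≡ false
  any-false-intro [] = refl
  any-false-intro (fy ∷ fs) rewrite fy = any-false-intro fs

  Any-All-clash : ∀ {f : A → Bool} {xs} → Any (λ x → f x ≡ true) xs → All (λ x → f x ≡ false) xs → ⊥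
  Any-All-clash q fs with find q
  ... | _ , xm , fx = true≢false fx (All.lookup fs xm)

  Any-map-∈ : ∀ {Q R : A → Set} {xs} → (∀ {x} → x ∈ xs → Q x → R x) → Any Q xs → Any R xs
  Any-map-∈ h q with find q
  ... | _ , xm , qx = lose xm (h xm qx)

  ∈-[] : ∀ {x : A} {xs} → xs ≡ [] → x ∈ xs → ⊥
  ∈-[] refl ()

  null-true : ∀ {xs : List A} → null xs ≡ true → xs ≡ []
  null-true {[]} _ = refl

  ∈→0<length : ∀ {x : A} {xs} → x ∈ xs → 0 < length xs
  ∈→0<length (here _) = s≤s z≤n
  ∈→0<length (there _) = s≤s z≤n

-- Descending chains of finite sets stabilise

module _ {A : Set} where

  count : (A → Bool) → List A → ℕ
  count f [] = 0
  count f (x ∷ xs) = if f x then suc (count f xs) else count f xs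

  count-all : ∀ xs → count (λ _ → true) xs ≡ length xs
  count-all [] = refl
  count-all (_ ∷ xs) = cong suc (count-all xs)

  count-mono : ∀ {f g : A → Bool} → (∀ x → f x ≡ true → g x ≡ true) →
               ∀ xs → count f xs ≤ count g xs
  count-mono h [] = z≤n
  count-mono {f} {g} h (y ∷ ys) with f y in fy | g y in gy
  ... | true | true = s≤s (count-mono h ys)
  ... | true | false = ⊥-elim (true≢false (h y fy) gy)
  ... | false | true = m≤n⇒m≤1+n (count-mono h ys)
  ... | false | false = count-mono h ys

  count-strict : ∀ {f g : A → Bool} → (∀ x → f x ≡ true → g x ≡ true) →
                 ∀ {x} xs → x ∈ xs → f x ≡ false → g x ≡ true → count f xs < count g xs
  count-strict h (_ ∷ ys) (here refl) fx gx rewrite fx | gx = s≤s (count-mono h ys)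
  count-strict {f} {g} h (y ∷ ys) (there xm) fx gx with f y in fy | g y in gy
  ... | true | true = s≤s (count-strict h ys xm fx gx)
  ... | true | false = ⊥-elim (true≢false (h y fy) gy)
  ... | false | true = m<n⇒m<1+n (count-strict h ys xm fx gx)
  ... | false | false = count-strict h ys xm fx gx

  count<length : ∀ {f : A → Bool} {x} xs → x ∈ xs → f x ≡ false → count f xs < length xs
  count<length {f} xs xm fx = subst (count f xs <_) (count-all xs) (count-strict (λ _ _ → refl) xs xm fx refl)

  count-agree : ∀ {f g : A → Bool} → (∀ x → f x ≡ true → g x ≡ true) →
                ∀ {xs} → count f xs ≡ count g xs → ∀ {x} → x ∈ xs → f x ≡ g x
  count-agree {f} {g} h {xs} same {x} xm with f x in fx | g x in gx
  ... | true | true = refl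
  ... | false | false = refl
  ... | true | false = ⊥-elim (true≢false (h x fx) gx)
  ... | false | true = ⊥-elim (<-irrefl same (count-strict h xs xm fx gx))

  Descending : (ℕ → A → Bool) → Set
  Descending f = ∀ j a → f (suc j) a ≡ true → f j a ≡ true

  StableAt : (ℕ → A → Bool) → List A → ℕ → Set
  StableAt f xs k = ∀ {x} → x ∈ xs → f (suc k) x ≡ f k x

  stable-or-shrinking : ∀ {f : ℕ → A → Bool} → Descending f → ∀ xs j →
    Σ ℕ (λ k → k < j × StableAt f xs k) ⊎ count (f j) xs + j ≤ count (f 0) xs
  stable-or-shrinking desc xs zero = inj₂ (≤-reflexive (+-identityʳ _))
  stable-or-shrinking {f} desc xs (suc j) with stable-or-shrinking desc xs j
  ... | inj₁ (k , k<j , stable) = inj₁ (k , m<n⇒m<1+n k<j , stable)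
  ... | inj₂ shrunk with m≤n⇒m<n∨m≡n (count-mono (desc j) xs)
  ...   | inj₂ same = inj₁ (j , n<1+n j , count-agree (desc j) same)
  ...   | inj₁ lost = inj₂ (begin
          count (f (suc j)) xs + suc j   ≡⟨ +-suc _ j ⟩
          suc (count (f (suc j)) xs) + j ≤⟨ +-monoˡ-≤ j lost ⟩
          count (f j) xs + j             ≤⟨ shrunk ⟩
          count (f 0) xs                 ∎)
    where open ≤-Reasoning

  descending-stabilises : ∀ {f : ℕ → A → Bool} → Descending f → ∀ xs {x} → x ∈ xs → f 0 x ≡ false →
                          Σ ℕ (λ k → k < length xs × StableAt f xs k)
  descending-stabilises desc xs xm f0x with stable-or-shrinking desc xs (length xs)
  ... | inj₁ stable = stable
  ... | inj₂ shrunk = ⊥-elim (≤⇒≯ (≤-trans (m≤n+m _ _) shrunk) (count<length xs xm f0x))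

≡ᵇ-refl : ∀ a → (a ≡ᵇ a) ≡ true
≡ᵇ-refl zero = refl
≡ᵇ-refl (suc a) = ≡ᵇ-refl a

≡ᵇ-sound : ∀ a b → (a ≡ᵇ b) ≡ true → a ≡ b
≡ᵇ-sound zero zero _ = refl
≡ᵇ-sound (suc a) (suc b) e = cong suc (≡ᵇ-sound a b e)

inAt-sound : ∀ P {a} → inAt P a ≡ true → a ∈ atP P
inAt-sound P e = Any.map (λ {b} be → sym (≡ᵇ-sound b _ be)) (any-elim e)

inAt-complete : ∀ P {a} → a ∈ atP P → inAt P a ≡ true
inAt-complete P {a} am = any-intro (Any.map (λ { refl → ≡ᵇ-refl a }) am)

ruleAtoms : Rule → List Atom
ruleAtoms r = head r ++ pos r ++ neg r

atom-in-at : ∀ P {r x} → r ∈ P → x ∈ ruleAtoms r → inAt P x ≡ true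
atom-in-at P rm xm = inAt-complete P (∈-deduplicate⁺ _≟_ (∈-concatMap⁺ ruleAtoms (lose rm xm)))

single-distinct : ∀ b bs → length (deduplicate _≟_ (b ∷ bs)) ≤ 1 → ∀ {a} → a ∈ bs → a ≡ b
single-distinct b bs (s≤s le) {a} am with a ≟ b
... | yes a≡b = a≡b
... | no a≢b with ≤-trans (∈→0<length (∈-filter⁺ _ (∈-deduplicate⁺ _≟_ am) (λ b≡a → a≢b (sym b≡a)))) le
...   | ()

-- Models and reducts

satB : AtomSet → Rule → Bool
satB I r = any I (head r ++ neg r) ∨ any (λ a → not (I a)) (pos r)

sat-sound : ∀ I r → satB I r ≡ true → Satisfies I r
sat-sound I r e with any I (head r ++ neg r) in hn
... | true = inj₁ (any-elim hn)
... | false = inj₂ (Any.map not-true (any-elim e))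

sat-complete : ∀ I r → Satisfies I r → satB I r ≡ true
sat-complete I r (inj₁ q) = ∨-injˡ _ (any-intro q)
sat-complete I r (inj₂ q) = ∨-injʳ _ (any-intro (Any.map not-false q))

model-transport : ∀ P {I K : AtomSet} → (∀ a → inAt P a ≡ true → I a ≡ K a) → Model I P → Model K P
model-transport P {I} {K} agree IM = All.tabulate λ rm → transport rm (All.lookup IM rm)
  where
  same : ∀ {r x} → r ∈ P → x ∈ ruleAtoms r → I x ≡ K x
  same rm xm = agree _ (atom-in-at P rm xm)
  headNeg⊆atoms : ∀ {r x} → x ∈ head r ++ neg r → x ∈ ruleAtoms r
  headNeg⊆atoms {r} xm with ∈-++⁻ (head r) xm
  ... | inj₁ h = ∈-++⁺ˡ h
  ... | inj₂ n = ∈-++⁺ʳ (head r) (∈-++⁺ʳ (pos r) n)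
  transport : ∀ {r} → r ∈ P → Satisfies I r → Satisfies K r
  transport {r} rm (inj₁ q) = inj₁ (Any-map-∈ (λ xm Ix → trans (sym (same rm (headNeg⊆atoms {r} xm))) Ix) q)
  transport {r} rm (inj₂ q) = inj₂ (Any-map-∈ (λ xm Ix → trans (sym (same rm (∈-++⁺ʳ (head r) (∈-++⁺ˡ xm)))) Ix) q)

model→reduct : ∀ {P I} → Model I P → ModelOfReduct I P I
model→reduct {I = I} = All.map reduce
  where
  reduce : ∀ {r} → Satisfies I r → All (λ a → I a ≡ false) (neg r) →
           Any (λ a → I a ≡ true) (head r) ⊎ Any (λ a → I a ≡ false) (pos r)
  reduce {r} (inj₁ q) negFalse with ++⁻ (head r) q
  ... | inj₁ h = inj₁ h
  ... | inj₂ n = ⊥-elim (Any-All-clash n negFalse)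
  reduce (inj₂ q) _ = inj₂ q

reduct→model : ∀ {P I} → ModelOfReduct I P I → Model I P
reduct→model {I = I} = All.map restore
  where
  restore : ∀ {r} → (All (λ a → I a ≡ false) (neg r) →
                     Any (λ a → I a ≡ true) (head r) ⊎ Any (λ a → I a ≡ false) (pos r)) → Satisfies I r
  restore {r} red with any I (neg r) in negI
  ... | true = inj₁ (++⁺ʳ (head r) (any-elim negI))
  ... | false with red (any-false-elim negI)
  ...   | inj₁ h = inj₁ (++⁺ˡ h)
  ...   | inj₂ p = inj₂ p

-- An answer set only contains atoms of the program: I ∩ at(P) is a smaller model of P^I.
answer-set-atoms : ∀ {P I} → AnswerSet P I → I ⊆ inAt P
answer-set-atoms {P} {I} (IM , minimal) a Ia = ∧-projʳ {I a} (minimal J (λ _ → ∧-projˡ) JM a Ia)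
  where
  J : AtomSet
  J b = I b ∧ inAt P b
  JM : ModelOfReduct J P I
  JM = All.tabulate λ rm negFalse → restrict rm (All.lookup IM rm negFalse)
    where
    restrict : ∀ {r} → r ∈ P → Any (λ a → I a ≡ true) (head r) ⊎ Any (λ a → I a ≡ false) (pos r) →
               Any (λ a → J a ≡ true) (head r) ⊎ Any (λ a → J a ≡ false) (pos r)
    restrict rm (inj₁ q) = inj₁ (Any-map-∈ (λ hm Ih → ∧-intro Ih (atom-in-at P rm (∈-++⁺ˡ hm))) q)
    restrict rm (inj₂ q) = inj₂ (Any.map (λ {b} Ib → cong (_∧ inAt P b) Ib) q)

covered : AtomSet → AtomSet → Rule → Bool
covered L K r = any L (head r) ∨ any K (neg r)

allCovered : AtomSet → AtomSet → List Rule → Bool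
allCovered L K R = all (covered L K) R

reduct-model-covers : ∀ {P J I L K} → ModelOfReduct J P I → J ⊆ L → I ⊆ K →
                      ∀ {r} → r ∈ P → (∀ {a} → a ∈ pos r → J a ≡ true) → covered L K r ≡ true
reduct-model-covers {J = J} {L = L} {K} JM J⊆L I⊆K {r} rm posJ with any K (neg r) in negK
... | true = ∨-injʳ (any L (head r)) refl
... | false with All.lookup JM rm (All.map (⊆-false I⊆K) (any-false-elim negK))
...   | inj₁ h = ∨-injˡ _ (any-intro (Any.map (J⊆L _) h))
...   | inj₂ q with find q
...     | _ , am , Ja = ⊥-elim (true≢false (posJ am) Ja)

eval-⋀ : ∀ M {A : Set} (g : A → Formula) xs → eval M (⋀ (map g xs)) ≡ all (λ x → eval M (g x)) xs
eval-⋀ M g [] = refl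
eval-⋀ M g (x ∷ xs) = cong (eval M (g x) ∧_) (eval-⋀ M g xs)

eval-⋁ : ∀ M {A : Set} (g : A → Formula) xs → eval M (⋁ (map g xs)) ≡ any (λ x → eval M (g x)) xs
eval-⋁ M g [] = refl
eval-⋁ M g (x ∷ xs) = cong (eval M (g x) ∨_) (eval-⋁ M g xs)

eval-⋁-++ : ∀ M φs ψs → eval M (⋁ (φs ++ ψs)) ≡ eval M (⋁ φs) ∨ eval M (⋁ ψs)
eval-⋁-++ M [] ψs = refl
eval-⋁-++ M (φ ∷ φs) ψs = trans (cong (eval M φ ∨_) (eval-⋁-++ M φs ψs)) (sym (∨-assoc (eval M φ) _ _))

⋀-elim : ∀ M {A} (g : A → Formula) {xs x} → eval M (⋀ (map g xs)) ≡ true → x ∈ xs → eval M (g x) ≡ true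
⋀-elim M g {xs} e = all-elim (trans (sym (eval-⋀ M g xs)) e)

⋀-intro : ∀ M {A} (g : A → Formula) {xs} → (∀ {x} → x ∈ xs → eval M (g x) ≡ true) → eval M (⋀ (map g xs)) ≡ true
⋀-intro M g {xs} h = trans (eval-⋀ M g xs) (all-intro h)

atomSet : (Var → Bool) → AtomSet
atomSet M a = M (atom a)

-- The translation of a fixed program

module _ (P : Program) where
  open Translation P hiding (FP)

  PrSingleton-rule : ∀ {b r} → r ∈ PrSingleton b → r ∈ P × (∀ {a} → a ∈ pos r → a ≡ b)
  PrSingleton-rule {b} {r} rS with ∈-filter⁻ _ rS
  ... | rPr , onlyB = proj₁ (∈-filter⁻ _ rPr) ,
                      λ {a} am → ≡ᵇ-sound a b (all-elim (∧-projʳ {not (null (pos r))} onlyB) am)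

  PrEmpty-rule : ∀ {r} → r ∈ PrEmpty → r ∈ P × pos r ≡ []
  PrEmpty-rule rE with ∈-filter⁻ _ rE
  ... | rPr , noPos = proj₁ (∈-filter⁻ _ rPr) , null-true noPos

  proper-rule : ∀ {r} → r ∈ P → head r ≢ [] → r ∈ Pr
  proper-rule rm h≢[] = ∈-filter⁺ _ rm (λ nullHead → h≢[] (null-true nullHead))

  proper-rule-kind : DualNormal P → ∀ {r} → r ∈ P → head r ≢ [] →
                     r ∈ PrEmpty ⊎ Σ Atom (λ b → b ∈ pos r × r ∈ PrSingleton b)
  proper-rule-kind dn {r} rm h≢[] with All.lookup dn rm
  ... | inj₁ h≡[] = ⊥-elim (h≢[] h≡[])
  ... | inj₂ oneAtom = classify (pos r) refl oneAtom
    where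
    classify : ∀ ps → pos r ≡ ps → length (deduplicate _≟_ ps) ≤ 1 →
               r ∈ PrEmpty ⊎ Σ Atom (λ b → b ∈ pos r × r ∈ PrSingleton b)
    classify [] noPos _ = inj₁ (∈-filter⁺ _ (proper-rule rm h≢[]) (cong null noPos))
    classify (b ∷ bs) posB oneAtom =
      inj₂ (b , subst (b ∈_) (sym posB) (here refl) , ∈-filter⁺ _ (proper-rule rm h≢[]) onlyB)
      where
      onlyB : not (null (pos r)) ∧ all (λ a → a ≡ᵇ b) (pos r) ≡ true
      onlyB rewrite posB = ∧-intro (≡ᵇ-refl b) (all-intro λ am →
        subst (λ c → (c ≡ᵇ b) ≡ true) (sym (single-distinct b bs oneAtom am)) (≡ᵇ-refl b))

  closed-reduct-model : DualNormal P → ∀ {I L} → ModelOfReduct I P I → L ⊆ I →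
    (∀ b → L b ≡ true → allCovered L I (PrSingleton b) ≡ true) → allCovered L I PrEmpty ≡ true →
    ModelOfReduct L P I
  closed-reduct-model dn {I} {L} IM L⊆I coverSingle coverEmpty = All.tabulate cover
    where
    head-in-L : ∀ {R r} → r ∈ R → allCovered L I R ≡ true → All (λ a → I a ≡ false) (neg r) →
                Any (λ a → L a ≡ true) (head r)
    head-in-L rR cov negFalse = any-elim (∨-resolve (all-elim cov rR) (any-false-intro negFalse))
    cover : ∀ {r} → r ∈ P → All (λ a → I a ≡ false) (neg r) →
            Any (λ a → L a ≡ true) (head r) ⊎ Any (λ a → L a ≡ false) (pos r)
    cover {r} rm negFalse with null (head r) in nullHead
    ... | true with All.lookup IM rm negFalse
    ...   | inj₁ h = ⊥-elim (¬Any[] (subst (Any _) (null-true nullHead) h))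
    ...   | inj₂ q = inj₂ (Any.map (⊆-false L⊆I) q)
    cover {r} rm negFalse | false
      with proper-rule-kind dn rm (λ h≡[] → true≢false (cong null h≡[]) nullHead)
    ...   | inj₁ rE = inj₁ (head-in-L rE coverEmpty negFalse)
    ...   | inj₂ (b , bm , rS) with L b in Lb
    ...     | false = inj₂ (lose bm Lb)
    ...     | true = inj₁ (head-in-L rS (coverSingle b Lb) negFalse)

  agreeAtom : Atom → Atom → Formula
  agreeAtom m a = v (just a) 0 m ⇔f var (atom a)

  refineAtom : ℕ → Atom → Atom → Formula
  refineAtom j m a = v (just a) (suc j) m ⇔f (v (just a) j m ∧f C j m (PrSingleton a))

  modelClause : Rule → Formula
  modelClause r = ⋁ (map (λ a → var (atom a)) (head r ++ neg r)) ∨f ⋁ (map (λ a → ¬f var (atom a)) (pos r))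

  atomGuard : Atom → Formula
  atomGuard a = var (atom a) ⇒f (⋀ (map (λ i → F i a) (upTo (suc p))) ∧f (¬f v nothing p a))

  level : (Var → Bool) → ℕ → Atom → AtomSet
  level M i m a = M (sup (just a) i m)

  flag : (Var → Bool) → ℕ → Atom → Bool
  flag M i m = M (sup nothing i m)

  eval-C : ∀ M j m R → eval M (C j m R) ≡ allCovered (level M j m) (atomSet M) R
  eval-C M j m R = trans (eval-⋀ M _ R) (all-cong R λ r →
    trans (eval-⋁-++ M (map (λ a → v (just a) j m) (head r)) (map (λ a → var (atom a)) (neg r)))
          (cong₂ _∨_ (eval-⋁ M (λ a → v (just a) j m) (head r)) (eval-⋁ M (λ a → var (atom a)) (neg r))))

  Base : (Var → Bool) → Atom → Set
  Base M m = level M 0 m m ≡ false × flag M 0 m ≡ true ×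
             (∀ {a} → a ∈ atWithout m → level M 0 m a ≡ M (atom a))

  Step : (Var → Bool) → ℕ → Atom → Set
  Step M j m =
    (∀ {a} → a ∈ atWithout m →
       level M (suc j) m a ≡ level M j m a ∧ allCovered (level M j m) (atomSet M) (PrSingleton a)) ×
    flag M (suc j) m ≡ flag M j m ∧ allCovered (level M j m) (atomSet M) PrEmpty

  F-zero-meaning : ∀ M m → eval M (F 0 m) ≡ true ⇔ Base M m
  F-zero-meaning M m = mk⇔
    (λ e → not-true (∧-projˡ e) , ∧-projˡ (∧-projʳ {not (level M 0 m m)} e) ,
           λ {_} am → iff-true (⋀-elim M (agreeAtom m) (∧-projʳ {flag M 0 m} (∧-projʳ {not (level M 0 m m)} e)) am))
    (λ (notM , t , agree) → ∧-intro (not-false notM) (∧-intro t (⋀-intro M (agreeAtom m) λ am → iff-intro (agree am))))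

  F-suc-meaning : ∀ M j m → eval M (F (suc j) m) ≡ true ⇔ Step M j m
  F-suc-meaning M j m = mk⇔
    (λ e → (λ {a} am → trans (iff-true (⋀-elim M (refineAtom j m) (∧-projˡ e) am)) (coverS a))
         , trans (iff-true (∧-projʳ e)) coverE)
    (λ (levels , t) → ∧-intro (⋀-intro M (refineAtom j m) λ {a} am → iff-intro (trans (levels am) (sym (coverS a))))
                              (iff-intro (trans t (sym coverE))))
    where
    coverS : ∀ a → level M j m a ∧ eval M (C j m (PrSingleton a)) ≡
                   level M j m a ∧ allCovered (level M j m) (atomSet M) (PrSingleton a)
    coverS a = cong (level M j m a ∧_) (eval-C M j m (PrSingleton a))
    coverE : flag M j m ∧ eval M (C j m PrEmpty) ≡ flag M j m ∧ allCovered (level M j m) (atomSet M) PrEmpty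
    coverE = cong (flag M j m ∧_) (eval-C M j m PrEmpty)

  FMod-meaning : ∀ M → eval M FMod ≡ true ⇔ Model (atomSet M) P
  FMod-meaning M = mk⇔
    (λ e → All.tabulate λ {r} rm → sat-sound _ r (trans (sym (eval-clause r)) (⋀-elim M modelClause e rm)))
    (λ model → ⋀-intro M modelClause λ {r} rm → trans (eval-clause r) (sat-complete _ r (All.lookup model rm)))
    where
    eval-clause : ∀ r → eval M (modelClause r) ≡ satB (atomSet M) r
    eval-clause r = cong₂ _∨_ (eval-⋁ M _ (head r ++ neg r)) (eval-⋁ M _ (pos r))

  Guard : (Var → Bool) → Atom → Set
  Guard M x = (∀ i → i ≤ p → eval M (F i x) ≡ true) × flag M p x ≡ false

  FP-meaning : ∀ M → eval M (FP P) ≡ true ⇔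
               (eval M FMod ≡ true × (∀ {x} → x ∈ at → M (atom x) ≡ true → Guard M x))
  FP-meaning M = mk⇔
    (λ e → ∧-projˡ e , λ {_} xm Mx → guard (imp-elim (⋀-elim M atomGuard (∧-projʳ e) xm) Mx))
    (λ (fmod , guards) → ∧-intro fmod (⋀-intro M atomGuard λ xm → imp-intro λ Mx → unguard (guards xm Mx)))
    where
    guard : ∀ {x} → eval M (⋀ (map (λ i → F i x) (upTo (suc p)))) ∧ not (flag M p x) ≡ true → Guard M x
    guard {x} g = (λ i i≤p → ⋀-elim M (λ i → F i x) (∧-projˡ g) (∈-upTo⁺ (s≤s i≤p))) , not-true (∧-projʳ g)
    unguard : ∀ {x} → Guard M x → eval M (⋀ (map (λ i → F i x) (upTo (suc p)))) ∧ not (flag M p x) ≡ true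
    unguard {x} (Fs , t) = ∧-intro (⋀-intro M (λ i → F i x) λ im → Fs _ (s≤s⁻¹ (∈-upTo⁻ im))) (not-false t)

  module Soundness (M : Var → Bool) {I : AtomSet} (FP-true : eval M (FP P) ≡ true)
                   (I≈M : ∀ a → I a ≡ M (atom a) ∧ inAt P a) where

    I⊆M : I ⊆ atomSet M
    I⊆M a Ia = ∧-projˡ (trans (sym (I≈M a)) Ia)

    I⊆at : I ⊆ inAt P
    I⊆at a Ia = ∧-projʳ {M (atom a)} (trans (sym (I≈M a)) Ia)

    I-on-at : ∀ a → inAt P a ≡ true → M (atom a) ≡ I a
    I-on-at a inA = sym (trans (I≈M a) (trans (cong (M (atom a) ∧_) inA) (∧-identityʳ _)))

    model : ModelOfReduct I P I
    model = model→reduct (model-transport P I-on-at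
                           (to (FMod-meaning M) (proj₁ (to (FP-meaning M) FP-true))))

    trapped : ∀ {J x} → J ⊆ I → ModelOfReduct J P I → J x ≡ false →
              (∀ i → i ≤ p → eval M (F i x) ≡ true) → ∀ i → i ≤ p → J ⊆ level M i x × flag M i x ≡ true
    trapped {J} {x} J⊆I JM Jx Fs = go
      where
      J-in : ∀ {b} → J b ≡ true → b ∈ atWithout x
      J-in {b} Jb = ∈-filter⁺ _ (inAt-sound P (I⊆at b (J⊆I b Jb))) (λ { refl → true≢false Jb Jx })
      go : ∀ i → i ≤ p → J ⊆ level M i x × flag M i x ≡ true
      go zero _ with to (F-zero-meaning M x) (Fs 0 z≤n)
      ... | _ , t0 , agree = (λ b Jb → trans (agree (J-in Jb)) (I⊆M b (J⊆I b Jb))) , t0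
      go (suc i) i<p with go i (<⇒≤ i<p) | to (F-suc-meaning M i x) (Fs (suc i) i<p)
      ... | J⊆L , t | levels , t′ =
            (λ b Jb → trans (levels (J-in Jb)) (∧-intro (J⊆L b Jb) (all-intro (single-covered Jb))))
          , trans t′ (∧-intro t (all-intro empty-covered))
        where
        covers : ∀ {r} → r ∈ P → (∀ {a} → a ∈ pos r → J a ≡ true) → covered (level M i x) (atomSet M) r ≡ true
        covers = reduct-model-covers JM J⊆L I⊆M
        single-covered : ∀ {b r} → J b ≡ true → r ∈ PrSingleton b → covered (level M i x) (atomSet M) r ≡ true
        single-covered Jb rS with PrSingleton-rule rS
        ... | rm , onlyB = covers rm (λ am → subst (λ c → J c ≡ true) (sym (onlyB am)) Jb)
        empty-covered : ∀ {r} → r ∈ PrEmpty → covered (level M i x) (atomSet M) r ≡ true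
        empty-covered rE with PrEmpty-rule rE
        ... | rm , noPos = covers rm (λ am → ⊥-elim (∈-[] noPos am))

    minimal : ∀ J → J ⊆ I → ModelOfReduct J P I → I ⊆ J
    minimal J J⊆I JM x Ix with proj₂ (to (FP-meaning M) FP-true) (inAt-sound P (I⊆at x Ix)) (I⊆M x Ix)
    ... | Fs , ¬t = ¬-not λ Jx → true≢false (proj₂ (trapped J⊆I JM Jx Fs p ≤-refl)) ¬t

    answer-set : AnswerSet P I
    answer-set = model , minimal

  module Canonical (I : AtomSet) where

    chain : Atom → ℕ → AtomSet
    chain m zero a = I a ∧ not (a ≡ᵇ m)
    chain m (suc j) a = chain m j a ∧ allCovered (chain m j) I (PrSingleton a)

    flagChain : Atom → ℕ → Bool
    flagChain m zero = true
    flagChain m (suc j) = flagChain m j ∧ allCovered (chain m j) I PrEmpty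

    valuation : Var → Bool
    valuation (atom a) = I a
    valuation (sup (just a) j m) = chain m j a
    valuation (sup nothing j m) = flagChain m j

    chain-descends : ∀ m → Descending (chain m)
    chain-descends m j a = ∧-projˡ

    chain⊆I : ∀ m j → chain m j ⊆ I
    chain⊆I m zero a e = ∧-projˡ e
    chain⊆I m (suc j) a e = chain⊆I m j a (∧-projˡ e)

    chain-misses : ∀ m j → chain m j m ≡ false
    chain-misses m zero rewrite ≡ᵇ-refl m = ∧-zeroʳ (I m)
    chain-misses m (suc j) rewrite chain-misses m j = refl

    flag-descends : ∀ m {i j} → i ≤ j → flagChain m j ≡ true → flagChain m i ≡ true
    flag-descends m {j = zero} z≤n t = t
    flag-descends m {j = suc j} i≤j t with m≤n⇒m<n∨m≡n i≤j
    ... | inj₁ i<sj = flag-descends m (s≤s⁻¹ i<sj) (∧-projˡ t)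
    ... | inj₂ refl = t

    valuation-F : ∀ i m → eval valuation (F i m) ≡ true
    valuation-F zero m = from (F-zero-meaning valuation m) (chain-misses m 0 , refl , λ {a} am → outside-m am)
      where
      outside-m : ∀ {a} → a ∈ atWithout m → I a ∧ not (a ≡ᵇ m) ≡ I a
      outside-m {a} am with a≢m ← proj₂ (∈-filter⁻ _ {xs = at} am)
        rewrite ¬-not {a ≡ᵇ m} {true} (λ e → a≢m (≡ᵇ-sound a m e)) = ∧-identityʳ (I a)
    valuation-F (suc j) m = from (F-suc-meaning valuation j m) ((λ _ → refl) , refl)

  module Completeness (dn : DualNormal P) {I : AtomSet} (answer : AnswerSet P I) where
    open Canonical I

    -- for m ∈ I the chain stabilises at a model of P^I, so t^p_m must fail
    flag-refuted : ∀ {m} → m ∈ at → I m ≡ true → flagChain m p ≡ false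
    flag-refuted {m} mat Im with descending-stabilises (chain-descends m) at mat (chain-misses m 0)
    ... | k , k<p , stable =
          ¬-not λ t → true≢false (proj₂ answer (chain m k) (chain⊆I m k) (stable-model t) m Im) (chain-misses m k)
      where
      closed : ∀ b → chain m k b ≡ true → allCovered (chain m k) I (PrSingleton b) ≡ true
      closed b Lb = ∧-projʳ (trans (stable (inAt-sound P (answer-set-atoms answer b (chain⊆I m k b Lb)))) Lb)
      stable-model : flagChain m p ≡ true → ModelOfReduct (chain m k) P I
      stable-model t = closed-reduct-model dn (proj₁ answer) (chain⊆I m k) closed
                         (∧-projʳ {flagChain m k} (flag-descends m k<p t))

    canonical-model : Σ (Var → Bool) (λ M → (eval M (FP P) ≡ true) × (∀ a → I a ≡ (M (atom a) ∧ inAt P a)))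
    canonical-model = valuation , from (FP-meaning valuation) (FMod-true , guards) , agrees
      where
      FMod-true : eval valuation FMod ≡ true
      FMod-true = from (FMod-meaning valuation) (reduct→model (proj₁ answer))
      guards : ∀ {x} → x ∈ at → I x ≡ true → Guard valuation x
      guards xm Ix = (λ i _ → valuation-F i _) , flag-refuted xm Ix
      agrees : ∀ a → I a ≡ I a ∧ inAt P a
      agrees a = ∧-absorb (answer-set-atoms answer a)

theorem1 : (P : Program) → DualNormal P → (I : AtomSet) →
    (AnswerSet P I → Σ (Var → Bool) (λ M → (eval M (FP P) ≡ true) × (∀ a → I a ≡ (M (atom a) ∧ inAt P a))))
    × (Σ (Var → Bool) (λ M → (eval M (FP P) ≡ true) × (∀ a → I a ≡ (M (atom a) ∧ inAt P a))) → AnswerSet P I)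
theorem1 P dn I =
    (λ answer → Completeness.canonical-model P dn answer)
  , (λ (M , FP-true , I≈M) → Soundness.answer-set P M FP-true I≈M)
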